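{- Let $n\ge1$ and $0\le i\le 2n$. The map $\Phi_1$ restricts to an involution on $\mathcal{B}_i(2n,2n)\setminus\mathcal{F}_i(2n,2n)$, and for every $\pi$ in this set, $\mathrm{sump}(\Phi_1(\pi))$ has the opposite parity to $\mathrm{sump}(\pi)$.
   Context: Lattice paths start at $(0,0)$ with steps $\mathsf N=(0,1)$, $\mathsf E=(1,0)$. $\mathcal{B}(2n,2n)$ is the set of paths from $(0,0)$ to $(2n,2n)$; $\mathcal{B}_i(2n,2n)$ is the subset of paths passing through $(0,i)$ and $(1,i)$. A peak is an occurrence of consecutive steps $\mathsf N\mathsf E$, identified with the lattice point between them; $\mathrm{sump}$ of a path is the sum of the $x$- and $y$-coordinates of all its peaks. For a path $\omega$ from $(0,0)$ to $(n,n)$, $\gamma(\omega)$ is the path obtained by duplicating every step; $\mathcal{F}(2n,2n)=\{\gamma(\omega)\}$ over all such $\omega$, and $\mathcal{F}_i(2n,2n)=\mathcal{F}(2n,2n)\cap\mathcal{B}_i(2n,2n)$. The primal factorization of a path is $\mu_0\mu_1\cdots\mu_d$ where $\mu_{2i}$ are maximal runs of $\mathsf N$ steps and $\mu_{2i+1}$ maximal runs of $\mathsf E$ steps ($\mu_0$ empty if the path starts with $\mathsf E$). The map $\Phi_1:\mathcal{B}(2n,2n)\to\mathcal{B}(2n,2n)$ is defined as follows: if every $\mu_i$ has an even number of steps, $\Phi_1(\pi)=\pi$; otherwise let $k$ be the greatest index such that $\mu_k$ has odd length, and $\Phi_1(\pi)$ is obtained from $\pi$ by interchanging the first step of $\mu_k$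 with the last step of $\mu_{k-1}$. -}

module Defs where

open import Data.Nat using (ℕ; zero; suc; _+_; _*_; _∸_)
open import Data.Bool using (Bool; true; false; if_then_else_; not)
open import Data.List using (List; []; _∷_; _++_; replicate)
open import Data.Maybe using (Maybe; just; nothing)
open import Data.Product using (_×_; _,_; ∃)
open import Relation.Nullary using (¬_)
open import Relation.Binary.PropositionalEquality using (_≡_)

-- Steps N = (0,1), E = (1,0); a lattice path from (0,0) is a list of steps.
data Step : Set where
  N E : Step

Path : Set
Path = List Step

sameStep : Step → Step → Bool
sameStep N N = true
sameStep E E = true
sameStep _ _ = false

countN : Path → ℕ
countN [] = 0
countN (N ∷ p) = suc (countN p)
countN (E ∷ p) = countN p

countE : Path → ℕ
countE [] = 0
countE (E ∷ p) = suc (countE p)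
countE (N ∷ p) = countE p

InB : ℕ → Path → Set
InB n π = (countN π ≡ 2 * n) × (countE π ≡ 2 * n)

-- 𝓑_i(2n,2n): additionally passes through (0,i) and (1,i),
-- i.e. begins with i N-steps followed by an E-step.
InBi : ℕ → ℕ → Path → Set
InBi n i π = InB n π × ∃ λ rest → π ≡ replicate i N ++ (E ∷ rest)

dup : Path → Path
dup [] = []
dup (s ∷ p) = s ∷ s ∷ dup p

InF : ℕ → Path → Set
InF n π = ∃ λ ω → (countN ω ≡ n) × (countE ω ≡ n) × (π ≡ dup ω)

InFi : ℕ → ℕ → Path → Set
InFi n i π = InF n π × InBi n i π

-- sum of x+y over all peaks (NE factors; the peak is the point between
-- the two steps), starting from current position (x , y)
sumpFrom : ℕ → ℕ → Path → ℕ
sumpFrom x y [] = 0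
sumpFrom x y (N ∷ E ∷ rest) = (x + suc y) + sumpFrom x (suc y) (E ∷ rest)
sumpFrom x y (N ∷ rest) = sumpFrom x (suc y) rest
sumpFrom x y (E ∷ rest) = sumpFrom (suc x) y rest

sump : Path → ℕ
sump = sumpFrom 0 0

runs : Path → List (Step × ℕ)
runs [] = []
runs (s ∷ xs) with runs xs
... | [] = (s , 1) ∷ []
... | (t , m) ∷ rs = if sameStep s t then (t , suc m) ∷ rs else (s , 1) ∷ (t , m) ∷ rs

unruns : List (Step × ℕ) → Path
unruns [] = []
unruns ((s , a) ∷ rs) = replicate a s ++ unruns rs

isOdd : ℕ → Bool
isOdd zero = false
isOdd (suc m) = not (isOdd m)

-- fixRuns rs = just π' when some run of rs other than the first has odd
-- length; π' is obtained by swapping the first step of the LAST odd run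
-- with the last step of the run preceding it.  (The empty μ₀ of the primal
-- factorization has even length, so it is never the selected run, and
-- indexing shifts do not affect "greatest index with odd length".)
fixRuns : List (Step × ℕ) → Maybe Path
fixRuns [] = nothing
fixRuns ((s , a) ∷ rest) with fixRuns rest
... | just r = just (replicate a s ++ r)
... | nothing with rest
...   | [] = nothing
...   | (t , b) ∷ post =
        if isOdd b
        then just (replicate (a ∸ 1) s ++ (t ∷ s ∷ (replicate (b ∸ 1) t ++ unruns post)))
        else nothing

-- Φ₁: identity if all runs are even (or, in the degenerate case not
-- arising on 𝓑(2n,2n), if only the first run is odd)
Φ₁ : Path → Path
Φ₁ π with fixRuns (runs π)
... | just π' = π'
... | nothing = π

module Submission where

-- Cut π ∈ 𝓑(2n,2n) into consecutive pairs of steps.  π ∈ 𝓕 exactly when every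
-- pair is NN or EE; otherwise π = A s t γ(ω) with |A| even and {s,t} = {N,E}.
-- After A s the runs of π are an odd run of t followed by even runs, so the
-- last odd run starts at t and Φ₁ swaps s and t.  The result A t s γ(ω) has
-- the same shape, hence Φ₁ is an involution off 𝓕.  The swap happens at a
-- point of even coordinate sum |A|: NE has a peak of odd sum |A| + 1, while
-- the peaks EN may create have sums |A| and |A| + 2, so sump changes parity.
-- The swap keeps the numbers of N and E steps, and keeps the prefix NⁱE unless
-- A has no E step; then π would have |A| + 1 + 2 countN ω N steps, an odd number.

open import Data.Nat using (ℕ; zero; suc; _≤_; _*_; _%_; _+_; _∸_; _≟_)
open import Data.Nat.Properties using (+-suc; +-identityʳ; +-comm; *-cancelˡ-≡; *-distribˡ-+)
open import Data.Nat.DivMod using ([m+n]%n≡m%n)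
open import Data.Bool using (true; false; not; _xor_; if_then_else_)
open import Data.Bool.Properties using (not-involutive; xor-same; not-¬)
open import Data.List using (List; []; _∷_; _++_; replicate; length)
open import Data.List.Properties using (∷-injectiveʳ)
open import Data.List.Relation.Unary.All using (All; []; _∷_)
open import Data.Maybe using (just; nothing)
open import Data.Maybe.Properties using (just-injective)
open import Data.Product using (_×_; _,_; ∃; ∃₂; map₂)
open import Data.Empty using (⊥-elim)
open import Function using (_∘_)
open import Relation.Nullary using (¬_; yes; no; contradiction)
open import Relation.Binary.PropositionalEquality
open ≡-Reasoning
open import Defs

isOdd-suc-suc : ∀ m → isOdd (suc (suc m)) ≡ isOdd m
isOdd-suc-suc m = not-involutive (isOdd m)

isOdd-+ : ∀ m n → isOdd (m + n) ≡ isOdd m xor isOdd n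
isOdd-+ zero    n = refl
isOdd-+ (suc m) n rewrite isOdd-+ m n with isOdd m
... | true  = not-involutive (isOdd n)
... | false = refl

isOdd-even-+ : ∀ k m → isOdd k ≡ false → isOdd (k + m) ≡ isOdd m
isOdd-even-+ k m k-even rewrite isOdd-+ k m | k-even = refl

isOdd-2* : ∀ m → isOdd (2 * m) ≡ false
isOdd-2* m = begin
  isOdd (m + (m + 0))       ≡⟨ isOdd-+ m (m + 0) ⟩
  isOdd m xor isOdd (m + 0) ≡⟨ cong (λ k → isOdd m xor isOdd k) (+-identityʳ m) ⟩
  isOdd m xor isOdd m       ≡⟨ xor-same (isOdd m) ⟩
  false                     ∎

isOdd-+-suc : ∀ x y → isOdd (x + y) ≡ false → isOdd (x + suc y) ≡ true
isOdd-+-suc x y x+y-even = trans (cong isOdd (+-suc x y)) (cong not x+y-even)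

+-suc-middle : ∀ x y z → x + suc y + z ≡ x + y + suc z
+-suc-middle x y z = trans (cong (_+ z) (+-suc x y)) (sym (+-suc (x + y) z))

isOdd-%2 : ∀ m → isOdd (m % 2) ≡ isOdd m
isOdd-%2 0 = refl
isOdd-%2 1 = refl
isOdd-%2 (suc (suc m)) = begin
  isOdd ((2 + m) % 2) ≡⟨ cong (isOdd ∘ (_% 2)) (+-comm 2 m) ⟩
  isOdd ((m + 2) % 2) ≡⟨ cong isOdd ([m+n]%n≡m%n m 2) ⟩
  isOdd (m % 2)       ≡⟨ isOdd-%2 m ⟩
  isOdd m             ≡⟨ isOdd-suc-suc m ⟨
  isOdd (2 + m)       ∎

infix 4 _≢ₚ_

_≢ₚ_ : ℕ → ℕ → Set
m ≢ₚ n = isOdd m ≡ not (isOdd n)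

≢ₚ-sym : ∀ {m n} → m ≢ₚ n → n ≢ₚ m
≢ₚ-sym {m} {n} m≢ₚn = trans (sym (not-involutive (isOdd n))) (cong not (sym m≢ₚn))

≢ₚ-suc : ∀ m → m ≢ₚ suc m
≢ₚ-suc m = sym (not-involutive (isOdd m))

+-congˡ-≢ₚ : ∀ k {m n} → m ≢ₚ n → k + m ≢ₚ k + n
+-congˡ-≢ₚ zero    m≢ₚn = m≢ₚn
+-congˡ-≢ₚ (suc k) m≢ₚn = cong not (+-congˡ-≢ₚ k m≢ₚn)

+-congʳ-≢ₚ : ∀ r {m n} → m ≢ₚ n → m + r ≢ₚ n + r
+-congʳ-≢ₚ r {m} {n} m≢ₚn rewrite +-comm m r | +-comm n r = +-congˡ-≢ₚ r m≢ₚn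

≢ₚ⇒%2≢ : ∀ {m n : ℕ} → m ≢ₚ n → m % 2 ≢ n % 2
≢ₚ⇒%2≢ {m} {n} m≢ₚn m%2≡n%2 = not-¬ refl (begin
  isOdd n       ≡⟨ isOdd-%2 n ⟨
  isOdd (n % 2) ≡⟨ cong isOdd m%2≡n%2 ⟨
  isOdd (m % 2) ≡⟨ isOdd-%2 m ⟩
  isOdd m       ≡⟨ m≢ₚn ⟩
  not (isOdd n) ∎)

data Distinct : Step → Step → Set where
  N≠E : Distinct N E
  E≠N : Distinct E N

Distinct-sym : ∀ {s t} → Distinct s t → Distinct t s
Distinct-sym N≠E = E≠N
Distinct-sym E≠N = N≠E

sameStep-distinct : ∀ {s t} → Distinct s t → sameStep s t ≡ false
sameStep-distinct N≠E = refl
sameStep-distinct E≠N = refl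

sameStep-refl : ∀ s → sameStep s s ≡ true
sameStep-refl N = refl
sameStep-refl E = refl

sameStep⇒≡ : ∀ s t → sameStep s t ≡ true → s ≡ t
sameStep⇒≡ N N _ = refl
sameStep⇒≡ E E _ = refl

countN-++ : ∀ A B → countN (A ++ B) ≡ countN A + countN B
countN-++ []      B = refl
countN-++ (N ∷ A) B = cong suc (countN-++ A B)
countN-++ (E ∷ A) B = countN-++ A B

countN+countE≡length : ∀ π → countN π + countE π ≡ length π
countN+countE≡length []      = refl
countN+countE≡length (N ∷ π) = cong suc (countN+countE≡length π)
countN+countE≡length (E ∷ π) = trans (+-suc (countN π) (countE π)) (cong suc (countN+countE≡length π))

countN-dup : ∀ ω → countN (dup ω) ≡ 2 * countN ω
countN-dup []      = refl
countN-dup (N ∷ ω) = begin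
  2 + countN (dup ω) ≡⟨ cong (2 +_) (countN-dup ω) ⟩
  2 + 2 * countN ω   ≡⟨ *-distribˡ-+ 2 1 (countN ω) ⟨
  2 * suc (countN ω) ∎
countN-dup (E ∷ ω) = countN-dup ω

countE-dup : ∀ ω → countE (dup ω) ≡ 2 * countE ω
countE-dup []      = refl
countE-dup (E ∷ ω) = begin
  2 + countE (dup ω) ≡⟨ cong (2 +_) (countE-dup ω) ⟩
  2 + 2 * countE ω   ≡⟨ *-distribˡ-+ 2 1 (countE ω) ⟨
  2 * suc (countE ω) ∎
countE-dup (N ∷ ω) = countE-dup ω

countN-distinct : ∀ {s t} → Distinct s t → ∀ B → countN (s ∷ t ∷ B) ≡ suc (countN B)
countN-distinct N≠E B = refl
countN-distinct E≠N B = refl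

countN-swap : ∀ A s t B → countN (A ++ s ∷ t ∷ B) ≡ countN (A ++ t ∷ s ∷ B)
countN-swap []      N N B = refl
countN-swap []      N E B = refl
countN-swap []      E N B = refl
countN-swap []      E E B = refl
countN-swap (N ∷ A) s t B = cong suc (countN-swap A s t B)
countN-swap (E ∷ A) s t B = countN-swap A s t B

countE-swap : ∀ A s t B → countE (A ++ s ∷ t ∷ B) ≡ countE (A ++ t ∷ s ∷ B)
countE-swap []      N N B = refl
countE-swap []      N E B = refl
countE-swap []      E N B = refl
countE-swap []      E E B = refl
countE-swap (E ∷ A) s t B = cong suc (countE-swap A s t B)
countE-swap (N ∷ A) s t B = countE-swap A s t B

data Paired : Path → Set where
  []   : Paired []
  pair : ∀ x y {π} → Paired π → Paired (x ∷ y ∷ π)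

Paired⇒even : ∀ {π} → Paired π → isOdd (length π) ≡ false
Paired⇒even []              = refl
Paired⇒even (pair _ _ {π} p) = trans (isOdd-suc-suc (length π)) (Paired⇒even p)

even⇒Paired : ∀ π → isOdd (length π) ≡ false → Paired π
even⇒Paired []          _    = []
even⇒Paired (x ∷ y ∷ π) even = pair x y (even⇒Paired π (trans (sym (isOdd-suc-suc (length π))) even))

InB⇒Paired : ∀ {n π} → InB n π → Paired π
InB⇒Paired {n} {π} (πN , πE) = even⇒Paired π (begin
  isOdd (length π)            ≡⟨ cong isOdd (countN+countE≡length π) ⟨
  isOdd (countN π + countE π) ≡⟨ cong₂ (λ a b → isOdd (a + b)) πN πE ⟩
  isOdd (2 * n + 2 * n)       ≡⟨ isOdd-even-+ (2 * n) (2 * n) (isOdd-2* n) ⟩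
  isOdd (2 * n)               ≡⟨ isOdd-2* n ⟩
  false                       ∎)

data PairView : Path → Set where
  doubled  : ∀ ω → PairView (dup ω)
  unpaired : ∀ {A} → Paired A → ∀ {s t} → Distinct s t → ∀ ω → PairView (A ++ s ∷ t ∷ dup ω)

pairView : ∀ {π} → Paired π → PairView π
pairView [] = doubled []
pairView (pair x y p) with pairView p
... | unpaired pA d ω = unpaired (pair x y pA) d ω
... | doubled ω = headPair x y
  where
  headPair : ∀ x y → PairView (x ∷ y ∷ dup ω)
  headPair N N = doubled (N ∷ ω)
  headPair E E = doubled (E ∷ ω)
  headPair N E = unpaired [] N≠E ω
  headPair E N = unpaired [] E≠N ω

unpaired-≢-dup : ∀ {A B : Path} {s t : Step} → Paired A → Distinct s t → ∀ ω → A ++ s ∷ t ∷ B ≢ dup ω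
unpaired-≢-dup []            N≠E (_ ∷ _) ()
unpaired-≢-dup []            E≠N (_ ∷ _) ()
unpaired-≢-dup (pair _ _ pA) d   (_ ∷ ω) eq = unpaired-≢-dup pA d ω (∷-injectiveʳ (∷-injectiveʳ eq))

push : Step → List (Step × ℕ) → List (Step × ℕ)
push s []             = (s , 1) ∷ []
push s ((t , m) ∷ rs) = if sameStep s t then (t , suc m) ∷ rs else (s , 1) ∷ (t , m) ∷ rs

runs-∷ : ∀ s π → runs (s ∷ π) ≡ push s (runs π)
runs-∷ s π with runs π
... | []    = refl
... | _ ∷ _ = refl

unruns-push : ∀ s rs → unruns (push s rs) ≡ s ∷ unruns rs
unruns-push s []             = refl
unruns-push s ((t , m) ∷ rs) with sameStep s t in same
... | true rewrite sameStep⇒≡ s t same = refl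
... | false = refl

unruns-runs : ∀ π → unruns (runs π) ≡ π
unruns-runs []      = refl
unruns-runs (s ∷ π) = begin
  unruns (runs (s ∷ π))    ≡⟨ cong unruns (runs-∷ s π) ⟩
  unruns (push s (runs π)) ≡⟨ unruns-push s (runs π) ⟩
  s ∷ unruns (runs π)      ≡⟨ cong (s ∷_) (unruns-runs π) ⟩
  s ∷ π                    ∎

push-positive : ∀ s rs → ∃ λ t → ∃₂ λ m rs′ → push s rs ≡ (t , suc m) ∷ rs′
push-positive s []             = s , 0 , [] , refl
push-positive s ((t , m) ∷ rs) with sameStep s t
... | true  = t , m , rs , refl
... | false = s , 0 , (t , m) ∷ rs , refl

fixRuns-grow : ∀ t m rs {Q} → fixRuns ((t , suc m) ∷ rs) ≡ just Q →
               fixRuns ((t , suc (suc m)) ∷ rs) ≡ just (t ∷ Q)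
fixRuns-grow t m rs h with fixRuns rs
... | just _ = cong (just ∘ (t ∷_)) (just-injective h)
... | nothing with rs
-- The omitted cases are those where the premise reduces to nothing ≡ just Q.
...   | (_ , b) ∷ _ with isOdd b
...     | true = cong (just ∘ (t ∷_)) (just-injective h)

fixRuns-push : ∀ a t m rs {Q} → fixRuns ((t , suc m) ∷ rs) ≡ just Q →
               fixRuns (push a ((t , suc m) ∷ rs)) ≡ just (a ∷ Q)
fixRuns-push a t m rs h with sameStep a t in same
... | true rewrite sameStep⇒≡ a t same = fixRuns-grow t m rs h
... | false rewrite h = refl

fixRuns-runs-∷ : ∀ a π {Q} → fixRuns (runs π) ≡ just Q → fixRuns (runs (a ∷ π)) ≡ just (a ∷ Q)
fixRuns-runs-∷ a (p ∷ π) h with push-positive p (runs π)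
... | t , m , rs , push-p rewrite runs-∷ a (p ∷ π) | runs-∷ p π | push-p = fixRuns-push a t m rs h

fixRuns-runs-++ : ∀ A {π Q} → fixRuns (runs π) ≡ just Q → fixRuns (runs (A ++ π)) ≡ just (A ++ Q)
fixRuns-runs-++ []      h = h
fixRuns-runs-++ (a ∷ A) {π} h = fixRuns-runs-∷ a (A ++ π) (fixRuns-runs-++ A h)

EvenRun : Step × ℕ → Set
EvenRun (_ , m) = isOdd m ≡ false

push-onto-even : ∀ t rs → All EvenRun rs →
  ∃₂ λ b rs′ → push t rs ≡ (t , b) ∷ rs′ × isOdd b ≡ true × All EvenRun rs′
push-onto-even t []             _            = 1 , [] , refl , refl , []
push-onto-even N ((N , e) ∷ rs) (even ∷ evs) = suc e , rs , refl , cong not even , evs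
push-onto-even E ((E , e) ∷ rs) (even ∷ evs) = suc e , rs , refl , cong not even , evs
push-onto-even N ((E , e) ∷ rs) evs          = 1 , (E , e) ∷ rs , refl , refl , evs
push-onto-even E ((N , e) ∷ rs) evs          = 1 , (N , e) ∷ rs , refl , refl , evs

runs-dup-even : ∀ ω → All EvenRun (runs (dup ω))
runs-dup-even []      = []
runs-dup-even (x ∷ ω) with push-onto-even x (runs (dup ω)) (runs-dup-even ω)
... | b , rs , push-x , odd-b , evs
  rewrite runs-∷ x (x ∷ dup ω) | runs-∷ x (dup ω) | push-x | sameStep-refl x = cong not odd-b ∷ evs

fixRuns-evenTail : ∀ r rs → All EvenRun rs → fixRuns (r ∷ rs) ≡ nothing
fixRuns-evenTail _ []             []           = refl
fixRuns-evenTail _ ((t , b) ∷ rs) (even ∷ evs) rewrite fixRuns-evenTail (t , b) rs evs | even = refl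

fixRuns-lastOdd : ∀ s a t b rs → isOdd b ≡ true → All EvenRun rs →
  fixRuns ((s , a) ∷ (t , b) ∷ rs) ≡ just (replicate (a ∸ 1) s ++ t ∷ s ∷ replicate (b ∸ 1) t ++ unruns rs)
fixRuns-lastOdd s a t b rs odd-b evs rewrite fixRuns-evenTail (t , b) rs evs | odd-b = refl

fixRuns-runs-swap : ∀ {s t} → Distinct s t → ∀ ω → fixRuns (runs (s ∷ t ∷ dup ω)) ≡ just (t ∷ s ∷ dup ω)
fixRuns-runs-swap {s} {t} d ω with push-onto-even t (runs (dup ω)) (runs-dup-even ω)
... | suc b , rs , push-t , odd-b , evs = begin
  fixRuns (runs (s ∷ t ∷ dup ω))            ≡⟨ cong fixRuns runs-st ⟩
  fixRuns ((s , 1) ∷ (t , suc b) ∷ rs)      ≡⟨ fixRuns-lastOdd s 1 t (suc b) rs odd-b evs ⟩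
  just (t ∷ s ∷ replicate b t ++ unruns rs) ≡⟨ cong (λ τ → just (t ∷ s ∷ τ)) unruns-tail ⟩
  just (t ∷ s ∷ dup ω)                      ∎
  where
  runs-st : runs (s ∷ t ∷ dup ω) ≡ (s , 1) ∷ (t , suc b) ∷ rs
  runs-st = begin
    runs (s ∷ t ∷ dup ω)       ≡⟨ runs-∷ s (t ∷ dup ω) ⟩
    push s (runs (t ∷ dup ω))  ≡⟨ cong (push s) (trans (runs-∷ t (dup ω)) push-t) ⟩
    push s ((t , suc b) ∷ rs)  ≡⟨ cong (λ c → if c then (t , 2 + b) ∷ rs else (s , 1) ∷ (t , suc b) ∷ rs) (sameStep-distinct d) ⟩
    (s , 1) ∷ (t , suc b) ∷ rs ∎
  unruns-tail : replicate b t ++ unruns rs ≡ dup ω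
  unruns-tail = ∷-injectiveʳ (begin
    unruns ((t , suc b) ∷ rs)      ≡⟨ cong unruns push-t ⟨
    unruns (push t (runs (dup ω))) ≡⟨ unruns-push t (runs (dup ω)) ⟩
    t ∷ unruns (runs (dup ω))      ≡⟨ cong (t ∷_) (unruns-runs (dup ω)) ⟩
    t ∷ dup ω                      ∎)

Φ₁-fixRuns : ∀ π {Q} → fixRuns (runs π) ≡ just Q → Φ₁ π ≡ Q
Φ₁-fixRuns π h rewrite h = refl

Φ₁-swap : ∀ A {s t} → Distinct s t → ∀ ω → Φ₁ (A ++ s ∷ t ∷ dup ω) ≡ A ++ t ∷ s ∷ dup ω
Φ₁-swap A d ω = Φ₁-fixRuns (A ++ _) (fixRuns-runs-++ A (fixRuns-runs-swap d ω))

Through : ℕ → Path → Set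
Through i π = ∃ λ rest → π ≡ replicate i N ++ E ∷ rest

Through-++ : ∀ i A {B B′} → countE A ≢ 0 → Through i (A ++ B) → Through i (A ++ B′)
Through-++ i       []      A-has-E _          = ⊥-elim (A-has-E refl)
Through-++ zero    (E ∷ A) {B′ = B′} _ _      = A ++ B′ , refl
Through-++ (suc i) (N ∷ A) A-has-E (rest , eq) =
  map₂ (cong (N ∷_)) (Through-++ i A A-has-E (rest , ∷-injectiveʳ eq))

countN-unpaired-odd : ∀ {A s t} → Paired A → countE A ≡ 0 → Distinct s t → ∀ ω →
                      isOdd (countN (A ++ s ∷ t ∷ dup ω)) ≡ true
countN-unpaired-odd {A} {s} {t} pA noE d ω = begin
  isOdd (countN (A ++ s ∷ t ∷ dup ω))       ≡⟨ cong isOdd (countN-++ A (s ∷ t ∷ dup ω)) ⟩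
  isOdd (countN A + countN (s ∷ t ∷ dup ω)) ≡⟨ isOdd-even-+ (countN A) _ countN-A-even ⟩
  isOdd (countN (s ∷ t ∷ dup ω))            ≡⟨ cong isOdd (countN-distinct d (dup ω)) ⟩
  not (isOdd (countN (dup ω)))              ≡⟨ cong (not ∘ isOdd) (countN-dup ω) ⟩
  not (isOdd (2 * countN ω))                ≡⟨ cong not (isOdd-2* (countN ω)) ⟩
  true                                      ∎
  where
  countN-A-even : isOdd (countN A) ≡ false
  countN-A-even = begin
    isOdd (countN A)            ≡⟨ cong isOdd (+-identityʳ (countN A)) ⟨
    isOdd (countN A + 0)        ≡⟨ cong (isOdd ∘ (countN A +_)) noE ⟨
    isOdd (countN A + countE A) ≡⟨ cong isOdd (countN+countE≡length A) ⟩
    isOdd (length A)            ≡⟨ Paired⇒even pA ⟩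
    false                       ∎

InBi-swap : ∀ {n i A s t} → Paired A → Distinct s t → ∀ ω →
            InBi n i (A ++ s ∷ t ∷ dup ω) → InBi n i (A ++ t ∷ s ∷ dup ω)
InBi-swap {n} {i} {A} {s} {t} pA d ω ((πN , πE) , through) =
  (trans (sym (countN-swap A s t _)) πN , trans (sym (countE-swap A s t _)) πE) , through′
  where
  through′ : Through i (A ++ t ∷ s ∷ dup ω)
  through′ with countE A ≟ 0
  ... | no  A-has-E = Through-++ i A A-has-E through
  ... | yes noE     = contradiction (begin
    true                                ≡⟨ countN-unpaired-odd pA noE d ω ⟨
    isOdd (countN (A ++ s ∷ t ∷ dup ω)) ≡⟨ cong isOdd πN ⟩
    isOdd (2 * n)                       ≡⟨ isOdd-2* n ⟩
    false                               ∎) λ ()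

InB-dup⇒InF : ∀ {n} ω → InB n (dup ω) → InF n (dup ω)
InB-dup⇒InF ω (πN , πE) =
    ω
  , *-cancelˡ-≡ _ _ 2 (trans (sym (countN-dup ω)) πN)
  , *-cancelˡ-≡ _ _ 2 (trans (sym (countE-dup ω)) πE)
  , refl

sumpFrom-NE-EN : ∀ x y B → isOdd (x + y) ≡ false →
                 sumpFrom x y (N ∷ E ∷ B) ≢ₚ sumpFrom x y (E ∷ N ∷ B)
sumpFrom-NE-EN x y []      x+y-even = +-congʳ-≢ₚ 0 {x + suc y} {0} (isOdd-+-suc x y x+y-even)
sumpFrom-NE-EN x y (N ∷ B) x+y-even =
  +-congʳ-≢ₚ (sumpFrom (suc x) (suc y) (N ∷ B)) {x + suc y} {0} (isOdd-+-suc x y x+y-even)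
sumpFrom-NE-EN x y (E ∷ B) _        =
  +-congʳ-≢ₚ (sumpFrom (suc x) (suc y) (E ∷ B)) {x + suc y} {suc x + suc y} (≢ₚ-suc (x + suc y))

sumpFrom-swap : ∀ A x y B → isOdd (x + y + length A) ≡ false →
                sumpFrom x y (A ++ N ∷ E ∷ B) ≢ₚ sumpFrom x y (A ++ E ∷ N ∷ B)
sumpFrom-swap []      x y B even =
  sumpFrom-NE-EN x y B (trans (cong isOdd (sym (+-identityʳ (x + y)))) even)
sumpFrom-swap (E ∷ A) x y B even =
  sumpFrom-swap A (suc x) y B (trans (cong isOdd (sym (+-suc (x + y) (length A)))) even)
sumpFrom-swap (N ∷ []) x y B even =
  trans (sumpFrom-NE-EN x (suc y) B peak-even)
        (cong not (sym (isOdd-even-+ (x + suc y) _ peak-even)))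
  where
  peak-even : isOdd (x + suc y) ≡ false
  peak-even = trans (cong isOdd (trans (sym (+-identityʳ (x + suc y))) (+-suc-middle x y 0))) even
sumpFrom-swap (N ∷ E ∷ A) x y B even =
  +-congˡ-≢ₚ (x + suc y) (sumpFrom-swap (E ∷ A) x (suc y) B (trans (cong isOdd (+-suc-middle x y _)) even))
sumpFrom-swap (N ∷ N ∷ A) x y B even =
  sumpFrom-swap (N ∷ A) x (suc y) B (trans (cong isOdd (+-suc-middle x y _)) even)

sump-swap : ∀ {A s t} → Paired A → Distinct s t → ∀ B → sump (A ++ t ∷ s ∷ B) % 2 ≢ sump (A ++ s ∷ t ∷ B) % 2
sump-swap {A} pA N≠E B =
  ≢ₚ⇒%2≢ {sump (A ++ E ∷ N ∷ B)} {sump (A ++ N ∷ E ∷ B)}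
    (≢ₚ-sym {sump (A ++ N ∷ E ∷ B)} {sump (A ++ E ∷ N ∷ B)} (sumpFrom-swap A 0 0 B (Paired⇒even pA)))
sump-swap {A} pA E≠N B =
  ≢ₚ⇒%2≢ {sump (A ++ N ∷ E ∷ B)} {sump (A ++ E ∷ N ∷ B)} (sumpFrom-swap A 0 0 B (Paired⇒even pA))

proposition4p5 : (n i : ℕ) → 1 ≤ n → i ≤ 2 * n →
    (π : Path) → InBi n i π → ¬ InFi n i π →
      (InBi n i (Φ₁ π) × ¬ InFi n i (Φ₁ π)) ×
      (Φ₁ (Φ₁ π) ≡ π) ×
      ¬ (sump (Φ₁ π) % 2 ≡ sump π % 2)
proposition4p5 n i _ _ π π∈Bᵢ@(π∈B , _) π∉Fᵢ with pairView (InB⇒Paired {n} {π} π∈B)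
... | doubled ω = ⊥-elim (π∉Fᵢ (InB-dup⇒InF ω π∈B , π∈Bᵢ))
... | unpaired {A} pA d ω rewrite Φ₁-swap A d ω | Φ₁-swap A (Distinct-sym d) ω =
    ( InBi-swap {n} {i} pA d ω π∈Bᵢ
    , λ ((ω′ , _ , _ , swapped≡dup) , _) → unpaired-≢-dup pA (Distinct-sym d) ω′ swapped≡dup )
  , refl
  , sump-swap pA d (dup ω)
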